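{- A solution $(X,\sigma,\tau)$ is left distributive if and only if its inverse solution $(X,\hat\sigma,\hat\tau)$ is right distributive.
   Context: A solution is a triple $(X,\sigma,\tau)$ with $X$ a non-empty set and bijections $\sigma_x,\tau_y$ of $X$ such that $r(x,y)=(\sigma_x(y),\tau_y(x))$ is a bijection of $X^2$ satisfying $(\mathrm{id}\times r)(r\times\mathrm{id})(\mathrm{id}\times r)=(r\times\mathrm{id})(\mathrm{id}\times r)(r\times\mathrm{id})$. The inverse solution $(X,\hat\sigma,\hat\tau)$ is defined by $r^{ -1}(x,y)=(\hat\sigma_x(y),\hat\tau_y(x))$. A solution is left distributive if $\sigma_x\sigma_y=\sigma_{\sigma_x(y)}\sigma_x$ for all $x,y$, and right distributive if $\tau_x\tau_y=\tau_{\tau_x(y)}\tau_x$ for all $x,y$. -}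

module Defs where

open import Level using (Level; suc)
open import Data.Product using (_×_; _,_; proj₁; proj₂)
open import Relation.Binary.PropositionalEquality using (_≡_)
open import Function using (_∘_)
open import Function.Definitions using (Bijective)

rMap : ∀ {ℓ} {X : Set ℓ} → (X → X → X) → (X → X → X) → X × X → X × X
rMap σ τ (x , y) = (σ x y , τ y x)

id×_ : ∀ {ℓ} {X : Set ℓ} → (X × X → X × X) → X × X × X → X × X × X
(id× f) (x , y , z) with f (y , z)
... | (y' , z') = (x , y' , z')

_×id : ∀ {ℓ} {X : Set ℓ} → (X × X → X × X) → X × X × X → X × X × X
(f ×id) (x , y , z) with f (x , y)
... | (x' , y') = (x' , y' , z)

record Solution (ℓ : Level) : Set (suc ℓ) where
  field
    X        : Set ℓ
    inhabit  : X
    σ        : X → X → X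
    τ        : X → X → X
    σ-bij    : ∀ x → Bijective _≡_ _≡_ (σ x)
    τ-bij    : ∀ y → Bijective _≡_ _≡_ (τ y)
    r-bij    : Bijective _≡_ _≡_ (rMap σ τ)
    braid    : ∀ t → (id× rMap σ τ) ((rMap σ τ ×id) ((id× rMap σ τ) t))
                   ≡ (rMap σ τ ×id) ((id× rMap σ τ) ((rMap σ τ ×id) t))

  r : X × X → X × X
  r = rMap σ τ

  r⁻¹ : X × X → X × X
  r⁻¹ p = proj₁ (proj₂ r-bij p)

  σ̂ : X → X → X
  σ̂ x y = proj₁ (r⁻¹ (x , y))

  τ̂ : X → X → X
  τ̂ y x = proj₂ (r⁻¹ (x , y))

DistributiveFamily : ∀ {ℓ} {X : Set ℓ} → (X → X → X) → Set ℓ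
DistributiveFamily f = ∀ x y z → f x (f y z) ≡ f (f x y) (f x z)

LeftDistributive : ∀ {ℓ} → Solution ℓ → Set ℓ
LeftDistributive S = DistributiveFamily (Solution.σ S)

InverseRightDistributive : ∀ {ℓ} → Solution ℓ → Set ℓ
InverseRightDistributive S = DistributiveFamily (Solution.τ̂ S)

{-# OPTIONS --safe #-}
module Submission where

open import Defs
open import Level using (Level)
open import Function using (_∘_)
open import Function.Bundles using (_⇔_; mk⇔; module Equivalence)
open import Data.Product using (_×_; _,_; proj₁; proj₂)
open import Relation.Binary.PropositionalEquality
  using (_≡_; refl; sym; trans; cong; cong₂; module ≡-Reasoning)

-- Both conditions reduce, via the first component of the braid relation for r
-- and the last component of the braid relation for r⁻¹, to index invariance:
-- σ_{τ_y(x)} = σ_x, respectively τ̂_{σ̂_y(x)} = τ̂_x. These two are equivalent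
-- because either of them forces τ̂_x = σ_x⁻¹, and the coordinates of
-- r ∘ r⁻¹ = id and r⁻¹ ∘ r = id then turn one into the other.

IndexInvariant : ∀ {ℓ} {X : Set ℓ} → (X → X → X) → (X → X → X) → Set ℓ
IndexInvariant f g = ∀ x y z → f (g y x) z ≡ f x z

distributive⇔indexInvariant : ∀ {ℓ} {X : Set ℓ} (f g : X → X → X) →
  (∀ x {a b} → f x a ≡ f x b → a ≡ b) →
  (∀ x y z → f x (f y z) ≡ f (f x y) (f (g y x) z)) →
  DistributiveFamily f ⇔ IndexInvariant f g
distributive⇔indexInvariant f g f-inj braid = mk⇔ to from
  where
  to : DistributiveFamily f → IndexInvariant f g
  to dist x y z = f-inj (f x y) (trans (sym (braid x y z)) (dist x y z))

  from : IndexInvariant f g → DistributiveFamily f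
  from inv x y z = trans (braid x y z) (cong (f (f x y)) (inv x y z))

braid-inverse : ∀ {ℓ} {B : Set ℓ} (R₁ R₂ Q₁ Q₂ : B → B) →
  (∀ t → R₁ (Q₁ t) ≡ t) → (∀ t → Q₁ (R₁ t) ≡ t) →
  (∀ t → R₂ (Q₂ t) ≡ t) → (∀ t → Q₂ (R₂ t) ≡ t) →
  (∀ t → R₂ (R₁ (R₂ t)) ≡ R₁ (R₂ (R₁ t))) →
  ∀ t → Q₂ (Q₁ (Q₂ t)) ≡ Q₁ (Q₂ (Q₁ t))
braid-inverse {B = B} R₁ R₂ Q₁ Q₂ R₁Q₁ Q₁R₁ R₂Q₂ Q₂R₂ braid t = begin
  Q₂ (Q₁ (Q₂ t))                   ≡⟨ cong (Q₂ ∘ Q₁ ∘ Q₂) (sym R₂R₁R₂u≡t) ⟩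
  Q₂ (Q₁ (Q₂ (R₂ (R₁ (R₂ u)))))    ≡⟨ cong (Q₂ ∘ Q₁) (Q₂R₂ _) ⟩
  Q₂ (Q₁ (R₁ (R₂ u)))              ≡⟨ cong Q₂ (Q₁R₁ _) ⟩
  Q₂ (R₂ u)                        ≡⟨ Q₂R₂ u ⟩
  u                                ∎
  where
  open ≡-Reasoning
  u : B
  u = Q₁ (Q₂ (Q₁ t))

  R₂R₁R₂u≡t : R₂ (R₁ (R₂ u)) ≡ t
  R₂R₁R₂u≡t = begin
    R₂ (R₁ (R₂ u))                 ≡⟨ braid u ⟩
    R₁ (R₂ (R₁ (Q₁ (Q₂ (Q₁ t)))))  ≡⟨ cong (R₁ ∘ R₂) (R₁Q₁ _) ⟩
    R₁ (R₂ (Q₂ (Q₁ t)))            ≡⟨ cong R₁ (R₂Q₂ _) ⟩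
    R₁ (Q₁ t)                      ≡⟨ R₁Q₁ t ⟩
    t                              ∎

module _ {ℓ} {X : Set ℓ} (f g : X × X → X × X) (fg : ∀ p → f (g p) ≡ p) where

  id×-inverse : ∀ t → (id× f) ((id× g) t) ≡ t
  id×-inverse (x , p) = cong (x ,_) (fg p)

  ×id-inverse : ∀ t → (f ×id) ((g ×id) t) ≡ t
  ×id-inverse (x , y , z) = cong (λ p → proj₁ p , proj₂ p , z) (fg (x , y))

module _ {ℓ} (S : Solution ℓ) where
  open Solution S

  r∘r⁻¹ : ∀ p → r (r⁻¹ p) ≡ p
  r∘r⁻¹ p = proj₂ (proj₂ r-bij p) refl

  r⁻¹∘r : ∀ p → r⁻¹ (r p) ≡ p
  r⁻¹∘r p = proj₁ r-bij (r∘r⁻¹ (r p))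

  σ-σ̂τ̂ : ∀ x y → σ (σ̂ x y) (τ̂ y x) ≡ x
  σ-σ̂τ̂ x y = cong proj₁ (r∘r⁻¹ (x , y))

  τ-τ̂σ̂ : ∀ x y → τ (τ̂ y x) (σ̂ x y) ≡ y
  τ-τ̂σ̂ x y = cong proj₂ (r∘r⁻¹ (x , y))

  σ̂-στ : ∀ x y → σ̂ (σ x y) (τ y x) ≡ x
  σ̂-στ x y = cong proj₁ (r⁻¹∘r (x , y))

  τ̂-τσ : ∀ x y → τ̂ (τ y x) (σ x y) ≡ y
  τ̂-τσ x y = cong proj₂ (r⁻¹∘r (x , y))

  σ-injective : ∀ x {a b} → σ x a ≡ σ x b → a ≡ b
  σ-injective x = proj₁ (σ-bij x)

  τ̂-injective : ∀ y {a b} → τ̂ y a ≡ τ̂ y b → a ≡ b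
  τ̂-injective y {a} {b} τ̂a≡τ̂b = begin
    a                        ≡⟨ sym (σ-σ̂τ̂ a y) ⟩
    σ (σ̂ a y) (τ̂ y a)        ≡⟨ cong₂ σ σ̂a≡σ̂b τ̂a≡τ̂b ⟩
    σ (σ̂ b y) (τ̂ y b)        ≡⟨ σ-σ̂τ̂ b y ⟩
    b                        ∎
    where
    open ≡-Reasoning
    σ̂a≡σ̂b : σ̂ a y ≡ σ̂ b y
    σ̂a≡σ̂b = proj₁ (τ-bij (τ̂ y a)) (trans (τ-τ̂σ̂ a y)
      (sym (trans (cong (λ c → τ c (σ̂ b y)) τ̂a≡τ̂b) (τ-τ̂σ̂ b y))))

  σ-braid : ∀ x y z → σ x (σ y z) ≡ σ (σ x y) (σ (τ y x) z)
  σ-braid x y z = cong proj₁ (braid (x , y , z))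

  r⁻¹-braid : ∀ t → (id× r⁻¹) ((r⁻¹ ×id) ((id× r⁻¹) t))
                  ≡ (r⁻¹ ×id) ((id× r⁻¹) ((r⁻¹ ×id) t))
  r⁻¹-braid = braid-inverse (r ×id) (id× r) (r⁻¹ ×id) (id× r⁻¹)
    (×id-inverse r r⁻¹ r∘r⁻¹) (×id-inverse r⁻¹ r r⁻¹∘r)
    (id×-inverse r r⁻¹ r∘r⁻¹) (id×-inverse r⁻¹ r r⁻¹∘r) braid

  τ̂-braid : ∀ x y z → τ̂ x (τ̂ y z) ≡ τ̂ (τ̂ x y) (τ̂ (σ̂ y x) z)
  τ̂-braid x y z = sym (cong (proj₂ ∘ proj₂) (r⁻¹-braid (z , y , x)))

  σ-invariant⇒τ̂-invariant : IndexInvariant σ τ → IndexInvariant τ̂ σ̂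
  σ-invariant⇒τ̂-invariant inv x y w = σ-injective x (begin
    σ x (τ̂ (σ̂ y x) w)             ≡⟨ σ-σ̂ x y (τ̂ (σ̂ y x) w) ⟩
    σ (σ̂ y x) (τ̂ (σ̂ y x) w)       ≡⟨ σ-τ̂ (σ̂ y x) w ⟩
    w                             ≡⟨ sym (σ-τ̂ x w) ⟩
    σ x (τ̂ x w)                   ∎)
    where
    open ≡-Reasoning
    σ-σ̂ : ∀ x y z → σ x z ≡ σ (σ̂ y x) z
    σ-σ̂ x y z = trans (cong (λ c → σ c z) (sym (τ-τ̂σ̂ y x))) (inv (σ̂ y x) (τ̂ x y) z)

    σ-τ̂ : ∀ y x → σ y (τ̂ y x) ≡ x
    σ-τ̂ y x = trans (σ-σ̂ y x (τ̂ y x)) (σ-σ̂τ̂ x y)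

  τ̂-invariant⇒σ-invariant : IndexInvariant τ̂ σ̂ → IndexInvariant σ τ
  τ̂-invariant⇒σ-invariant inv x y w = τ̂-injective x (begin
    τ̂ x (σ (τ y x) w)             ≡⟨ τ̂-τ x y (σ (τ y x) w) ⟩
    τ̂ (τ y x) (σ (τ y x) w)       ≡⟨ τ̂-σ (τ y x) w ⟩
    w                             ≡⟨ sym (τ̂-σ x w) ⟩
    τ̂ x (σ x w)                   ∎)
    where
    open ≡-Reasoning
    τ̂-τ : ∀ x y z → τ̂ x z ≡ τ̂ (τ y x) z
    τ̂-τ x y z = trans (cong (λ c → τ̂ c z) (sym (σ̂-στ x y))) (inv (τ y x) (σ x y) z)

    τ̂-σ : ∀ x y → τ̂ x (σ x y) ≡ y
    τ̂-σ x y = trans (τ̂-τ x y (σ x y)) (τ̂-τσ x y)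

corollary5p8 : ∀ {ℓ : Level} (S : Solution ℓ) → LeftDistributive S ⇔ InverseRightDistributive S
corollary5p8 S = mk⇔
  (λ ld → from τ̂-dist (σ-invariant⇒τ̂-invariant S (to σ-dist ld)))
  (λ rd → from σ-dist (τ̂-invariant⇒σ-invariant S (to τ̂-dist rd)))
  where
  open Solution S
  open Equivalence
  σ-dist : DistributiveFamily σ ⇔ IndexInvariant σ τ
  σ-dist = distributive⇔indexInvariant σ τ (σ-injective S) (σ-braid S)
  τ̂-dist : DistributiveFamily τ̂ ⇔ IndexInvariant τ̂ σ̂
  τ̂-dist = distributive⇔indexInvariant τ̂ σ̂ (τ̂-injective S) (τ̂-braid S)
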